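{- Let $k$, $n$ and $s$ be positive integers and let $x_1,\ldots,x_n$ be independent variables. Then $$H_k^{(s)}(x_1,\ldots,x_n)=\sum_{\substack{\lambda\vdash k\\ \lambda_i\equiv 0\text{ or }1\ (\mathrm{mod}\ s+1)\ \forall i}}(-1)^{k+\sum_{i=1}^{\ell(\lambda)}(\lambda_i\bmod (s+1))}\,m_\lambda(x_1,\ldots,x_n),$$ where the sum is over partitions $\lambda$ of $k$ all of whose parts are congruent to $0$ or $1$ modulo $s+1$, and $\lambda_i\bmod(s+1)$ denotes the least nonnegative residue.
   Context: For a positive integer $s$, $H_k^{(s)}$ ($k\ge0$) is defined by the formal power series identity $$\sum_{k\ge0}H_k^{(s)}(x_1,\ldots,x_n)t^k=\prod_{i=1}^n\big(1-x_it+\cdots+(-x_it)^s\big)^{ -1}.$$ $m_\lambda$ is the monomial symmetric function (zero if $\ell(\lambda)>n$) and $\ell(\lambda)$ is the number of parts of $\lambda$. -}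

module Defs where

open import Data.Nat as ℕ using (ℕ; zero; suc; _∸_; _⊓_; _%_)
import Data.Nat.Properties as ℕP
open import Data.Integer as ℤ using (ℤ; +_; -_; -1ℤ; 1ℤ; 0ℤ)
open import Data.List as L using (List; []; _∷_; map; concatMap; foldr; zipWith; filter; upTo; reverse; head)
import Data.List.Properties as LP
open import Data.Vec as V using (Vec; []; _∷_; toList; allFin)
import Data.Vec.Properties as VP
open import Data.Fin using (Fin; zero; suc)
open import Data.Product using (_×_; _,_)
open import Data.Maybe using (Maybe; just; nothing)
open import Relation.Binary.PropositionalEquality using (_≡_)
open import Relation.Nullary using (yes; no; Dec; ¬_)
open import Relation.Unary using (Decidable)
open import Data.List.Relation.Unary.All using (All; all?)
open import Data.Sum using (_⊎_)
import Data.Sum.Relation.Unary.All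
import Relation.Nullary.Decidable as Dec
import Data.List.Sort.InsertionSort.Base as ISort
open import Data.Nat.ListAction using (sum)

-- Polynomials in x₁,…,xₙ with integer coefficients, represented by
-- their coefficient function on exponent vectors (Vec ℕ n).
-- Two polynomials are equal iff all coefficients agree.

Mon : ℕ → Set
Mon n = Vec ℕ n

Poly : ℕ → Set
Poly n = Mon n → ℤ

splits : ∀ {n} → Mon n → List (Mon n × Mon n)
splits [] = ([] , []) ∷ []
splits (e ∷ es) =
  concatMap (λ i → map (λ { (a , b) → (i ∷ a , (e ∸ i) ∷ b) }) (splits es))
            (upTo (suc e))

Σℤ : List ℤ → ℤ
Σℤ = foldr ℤ._+_ 0ℤ

zeroP : ∀ {n} → Poly n
zeroP _ = 0ℤ

addP : ∀ {n} → Poly n → Poly n → Poly n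
addP p q e = p e ℤ.+ q e

scaleP : ∀ {n} → ℤ → Poly n → Poly n
scaleP c p e = c ℤ.* p e

negP : ∀ {n} → Poly n → Poly n
negP p e = - p e

mulP : ∀ {n} → Poly n → Poly n → Poly n
mulP p q e = Σℤ (map (λ { (a , b) → p a ℤ.* q b }) (splits e))

monomial : ∀ {n} → Mon n → Poly n
monomial e e' with VP.≡-dec ℕ._≟_ e e'
... | yes _ = 1ℤ
... | no  _ = 0ℤ

oneP : ∀ {n} → Poly n
oneP {n} = monomial (V.replicate n 0)

powVec : ∀ {n} → Fin n → ℕ → Mon n
powVec zero    j = j ∷ V.replicate _ 0
powVec (suc i) j = 0 ∷ powVec i j

-- Formal power series in t with coefficients in ℤ[x₁,…,xₙ]:
-- f k is the coefficient of t^k.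

PS : ℕ → Set
PS n = ℕ → Poly n

oneS : ∀ {n} → PS n
oneS zero    = oneP
oneS (suc _) = zeroP

mulS : ∀ {n} → PS n → PS n → PS n
mulS f g k = λ e → Σℤ (map (λ j → mulP (f j) (g (k ∸ j)) e) (upTo (suc k)))

-- Inverse of a power series f with constant term 1:
-- g 0 = 1, g (k+1) = - Σ_{j=1}^{k+1} f j · g (k+1-j).
-- invPrefix f k = [g k, g (k-1), …, g 0].
invPrefix : ∀ {n} → PS n → ℕ → List (Poly n)
invPrefix f zero = oneP ∷ []
invPrefix {n} f (suc k) = next ∷ prev
  where
  prev : List (Poly n)
  prev = invPrefix f k
  next : Poly n
  next = negP (foldr addP zeroP
           (zipWith (λ j g → mulP (f j) g) (L.map suc (upTo (suc k))) prev))

invS : ∀ {n} → PS n → PS n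
invS f k with invPrefix f k
... | g ∷ _ = g
... | []    = zeroP

factor : ∀ {n} → ℕ → Fin n → PS n
factor s i j with j ℕ.≤? s
... | yes _ = scaleP (-1ℤ ℤ.^ j) (monomial (powVec i j))
... | no  _ = zeroP

factorProduct : ℕ → (n : ℕ) → PS n
factorProduct s n = foldr (λ i acc → mulS (factor s i) acc) oneS (toList (allFin n))

H : (s n k : ℕ) → Poly n
H s n k = invS (factorProduct s n) k

-- weakly decreasing lists of positive integers, each ≤ m, summing to k
-- (the fuel argument f only needs to be ≥ k)
partitionsBounded : (f k m : ℕ) → List (List ℕ)
partitionsBounded f       zero    m = [] ∷ []
partitionsBounded zero    (suc k) m = []
partitionsBounded (suc f) (suc k) m =
  concatMap (λ p → map (p ∷_) (partitionsBounded f (suc k ∸ p) p))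
            (map suc (upTo (suc k ⊓ m)))

partitions : ℕ → List (List ℕ)
partitions k = partitionsBounded k k k

sortℕ : List ℕ → List ℕ
sortℕ = ISort.sort ℕP.≤-decTotalOrder

nonzeroEntries : ∀ {n} → Mon n → List ℕ
nonzeroEntries e = filter (λ a → Dec.¬? (a ℕ.≟ 0)) (toList e)

-- m_λ(x₁,…,xₙ): coefficient of x^e is 1 iff the nonzero entries of e,
-- as a multiset, are the parts of λ (so m_λ = 0 when ℓ(λ) > n)
monomialSym : ∀ {n} → List ℕ → Poly n
monomialSym λ' e with LP.≡-dec ℕ._≟_ (sortℕ (nonzeroEntries e)) (sortℕ λ')
... | yes _ = 1ℤ
... | no  _ = 0ℤ

residue01 : (s p : ℕ) → Set
residue01 s p = (p % suc s ≡ 0) ⊎ (p % suc s ≡ 1)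

residue01? : (s : ℕ) → Decidable (residue01 s)
residue01? s p = (p % suc s ℕ.≟ 0) Dec.⊎-dec (p % suc s ℕ.≟ 1)

admissible? : (s : ℕ) → Decidable (All (residue01 s))
admissible? s = all? (residue01? s)

residueSum : ℕ → List ℕ → ℕ
residueSum s λ' = sum (map (λ p → p % suc s) λ')

RHS : (s n k : ℕ) → Poly n
RHS s n k = foldr addP zeroP
  (map (λ λ' → scaleP (-1ℤ ℤ.^ (k ℕ.+ residueSum s λ')) (monomialSym λ'))
       (filter (admissible? s) (partitions k)))

-- In one variable, 1 − t + ⋯ + (−t)^s = (1 − (−t)^(s+1)) / (1 + t) has inverse
-- (1 + t) Σ_q (−t)^(q(s+1)), whose coefficient of t^a is (−1)^(a + a mod (s+1)) when
-- a ≡ 0 or 1 (mod s+1) and 0 otherwise (s ≥ 1 keeps these two residues apart).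
-- In n variables, both the product of the factors and the right-hand side are series whose
-- coefficient of t^k is the degree-k part of a coordinatewise product x^e ↦ ∏ᵢ Fᵢ(eᵢ): for the
-- right-hand side because the only partition λ such that m_λ contains x^e is the decreasing
-- rearrangement of the nonzero entries of e. Coordinatewise products multiply by convolving
-- each coordinate, so the one-variable identity makes the product of the two series 1, and the
-- inverse of a series with constant term 1 is unique.

module Submission where

open import Defs
open import Data.Nat as ℕ using (ℕ; zero; suc; _∸_; _%_; _/_; _<_; _≤_; z≤n; s≤s; NonZero; _⊓_)
import Data.Nat.Properties as ℕP
import Data.Nat.DivMod as DM
open import Data.Nat.ListAction using (sum)
import Data.Nat.ListAction.Properties as ℕLP
import Data.Nat.Tactic.RingSolver as ℕSolver
open import Data.Integer as ℤ using (ℤ; -_; -1ℤ; 1ℤ; 0ℤ; _+_; _*_; _^_)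
import Data.Integer.Properties as ℤP
open import Data.Integer.Tactic.RingSolver using (solve-∀)
open import Data.List using (List; []; _∷_; map; concatMap; foldr; upTo; applyUpTo; _++_; zipWith; filter)
import Data.List.Properties as LP
open import Data.List.Relation.Unary.All as All using (All; []; _∷_)
import Data.List.Relation.Unary.All.Properties as AllP
open import Data.List.Relation.Unary.Linked using (Linked; []; [-]; _∷_)
open import Data.List.Relation.Binary.Permutation.Propositional using (_↭_; ↭⇒↭ₛ; ↭-sym; module PermutationReasoning)
import Data.List.Relation.Binary.Permutation.Propositional.Properties as PermP
import Data.List.Relation.Binary.Pointwise as Pointwise
import Data.List.Relation.Unary.Sorted.TotalOrder.Properties as SortedP
import Data.List.Sort.InsertionSort.Base as ISort
import Data.List.Sort.InsertionSort.Properties as ISortP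
import Relation.Binary.Properties.DecTotalOrder as DecTotalOrderP
open import Data.Vec as V using (Vec; []; _∷_; toList; allFin)
import Data.Vec.Properties as VP
open import Data.Fin using (Fin; zero; suc)
open import Data.Product using (_×_; _,_; proj₁; proj₂)
open import Data.Sum using (_⊎_; inj₁; inj₂)
open import Data.Empty using (⊥-elim)
open import Function using (_∘_)
open import Relation.Binary.PropositionalEquality
open import Relation.Nullary using (yes; no; Dec; ¬_)
import Relation.Nullary.Decidable as Dec
open import Relation.Unary using (Decidable)
open import Relation.Binary.Bundles using (DecTotalOrder)
open import Level using (0ℓ)
open import Algebra.Properties.AbelianGroup ℤP.+-0-abelianGroup using (inverseˡ-unique)

𝟙 : ∀ {P : Set} → Dec P → ℤ
𝟙 (yes _) = 1ℤ
𝟙 (no _)  = 0ℤ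

𝟙-yes : ∀ {P : Set} → P → (d : Dec P) → 𝟙 d ≡ 1ℤ
𝟙-yes p (yes _) = refl
𝟙-yes p (no ¬p) = ⊥-elim (¬p p)

𝟙-no : ∀ {P : Set} → ¬ P → (d : Dec P) → 𝟙 d ≡ 0ℤ
𝟙-no ¬p (yes p) = ⊥-elim (¬p p)
𝟙-no ¬p (no _)  = refl

𝟙-⇔ : ∀ {P Q : Set} → (P → Q) → (Q → P) → (d : Dec P) (d′ : Dec Q) → 𝟙 d ≡ 𝟙 d′
𝟙-⇔ f g (yes p) d′ = sym (𝟙-yes (f p) d′)
𝟙-⇔ f g (no ¬p) d′ = sym (𝟙-no (λ q → ¬p (g q)) d′)

𝟙-× : ∀ {P Q R : Set} (d : Dec R) (d₁ : Dec P) (d₂ : Dec Q) →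
      (R → P × Q) → (P → Q → R) → 𝟙 d ≡ 𝟙 d₁ * 𝟙 d₂
𝟙-× d (yes p) (yes q) f g = 𝟙-yes (g p q) d
𝟙-× d (yes p) (no ¬q) f g = 𝟙-no (λ r → ¬q (proj₂ (f r))) d
𝟙-× d (no ¬p) d₂      f g = trans (𝟙-no (λ r → ¬p (proj₁ (f r))) d) (sym (ℤP.*-zeroˡ (𝟙 d₂)))

𝟙-⊎ : ∀ {P Q : Set} (d : Dec (P ⊎ Q)) (d₁ : Dec P) (d₂ : Dec Q) →
      ¬ (P × Q) → 𝟙 d ≡ 𝟙 d₁ + 𝟙 d₂
𝟙-⊎ d (yes p)  (yes q)  disj = ⊥-elim (disj (p , q))
𝟙-⊎ d (yes p)  (no _)   disj = 𝟙-yes (inj₁ p) d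
𝟙-⊎ d (no _)   (yes q)  disj = 𝟙-yes (inj₂ q) d
𝟙-⊎ d (no ¬p)  (no ¬q)  disj = 𝟙-no (λ { (inj₁ p) → ¬p p ; (inj₂ q) → ¬q q }) d

𝟙-≟-subst : ∀ {x y : ℕ} (d : Dec (x ≡ y)) (f : ℕ → ℤ) → 𝟙 d * f y ≡ 𝟙 d * f x
𝟙-≟-subst (yes refl) f = refl
𝟙-≟-subst (no _)     f = refl

monomial-𝟙 : ∀ {n} (p e : Mon n) → monomial p e ≡ 𝟙 (VP.≡-dec ℕ._≟_ p e)
monomial-𝟙 p e with VP.≡-dec ℕ._≟_ p e
... | yes _ = refl
... | no _  = refl

monomial-∷ : ∀ {n} a b (p e : Mon n) → monomial (a ∷ p) (b ∷ e) ≡ 𝟙 (a ℕ.≟ b) * monomial p e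
monomial-∷ a b p e = begin
  monomial (a ∷ p) (b ∷ e)                           ≡⟨ monomial-𝟙 (a ∷ p) (b ∷ e) ⟩
  𝟙 (VP.≡-dec ℕ._≟_ (a ∷ p) (b ∷ e))                 ≡⟨ 𝟙-× (VP.≡-dec ℕ._≟_ (a ∷ p) (b ∷ e)) (a ℕ.≟ b) _
                                                           VP.∷-injective (cong₂ _∷_) ⟩
  𝟙 (a ℕ.≟ b) * 𝟙 (VP.≡-dec ℕ._≟_ p e)               ≡⟨ cong (𝟙 (a ℕ.≟ b) *_) (monomial-𝟙 p e) ⟨
  𝟙 (a ℕ.≟ b) * monomial p e                         ∎
  where open ≡-Reasoning

Σℤ-++ : ∀ xs ys → Σℤ (xs ++ ys) ≡ Σℤ xs + Σℤ ys
Σℤ-++ []       ys = sym (ℤP.+-identityˡ _)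
Σℤ-++ (x ∷ xs) ys = trans (cong (x +_) (Σℤ-++ xs ys)) (sym (ℤP.+-assoc x _ _))

module _ {A : Set} where

  Σℤ-cong : ∀ {f g : A → ℤ} xs → (∀ x → f x ≡ g x) → Σℤ (map f xs) ≡ Σℤ (map g xs)
  Σℤ-cong []       eq = refl
  Σℤ-cong (x ∷ xs) eq = cong₂ _+_ (eq x) (Σℤ-cong xs eq)

  Σℤ-congᴬ : ∀ {P : A → Set} {f g : A → ℤ} {xs} → All P xs →
             (∀ {x} → P x → f x ≡ g x) → Σℤ (map f xs) ≡ Σℤ (map g xs)
  Σℤ-congᴬ []       eq = refl
  Σℤ-congᴬ (p ∷ ps) eq = cong₂ _+_ (eq p) (Σℤ-congᴬ ps eq)

  Σℤ-zero : ∀ (f : A → ℤ) xs → (∀ x → f x ≡ 0ℤ) → Σℤ (map f xs) ≡ 0ℤ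
  Σℤ-zero f []       eq = refl
  Σℤ-zero f (x ∷ xs) eq = cong₂ _+_ (eq x) (Σℤ-zero f xs eq)

  Σℤ-+ : ∀ (f g : A → ℤ) xs → Σℤ (map (λ x → f x + g x) xs) ≡ Σℤ (map f xs) + Σℤ (map g xs)
  Σℤ-+ f g []       = refl
  Σℤ-+ f g (x ∷ xs) = trans (cong ((f x + g x) +_) (Σℤ-+ f g xs)) (interchange (f x) (g x) _ _)
    where
    interchange : ∀ a b c d → (a + b) + (c + d) ≡ (a + c) + (b + d)
    interchange = solve-∀

  Σℤ-*ˡ : ∀ c (f : A → ℤ) xs → Σℤ (map (λ x → c * f x) xs) ≡ c * Σℤ (map f xs)
  Σℤ-*ˡ c f []       = sym (ℤP.*-zeroʳ c)
  Σℤ-*ˡ c f (x ∷ xs) = trans (cong (c * f x +_) (Σℤ-*ˡ c f xs)) (sym (ℤP.*-distribˡ-+ c (f x) _))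

  Σℤ-map-∘ : ∀ {B : Set} (g : B → ℤ) (f : A → B) xs → Σℤ (map g (map f xs)) ≡ Σℤ (map (g ∘ f) xs)
  Σℤ-map-∘ g f xs = cong Σℤ (sym (LP.map-∘ xs))

  Σℤ-concatMap : ∀ {B : Set} (F : B → List A) (g : A → ℤ) xs →
                 Σℤ (map g (concatMap F xs)) ≡ Σℤ (map (λ x → Σℤ (map g (F x))) xs)
  Σℤ-concatMap F g []       = refl
  Σℤ-concatMap F g (x ∷ xs) = begin
    Σℤ (map g (F x ++ concatMap F xs))
      ≡⟨ cong Σℤ (LP.map-++ g (F x) (concatMap F xs)) ⟩
    Σℤ (map g (F x) ++ map g (concatMap F xs))
      ≡⟨ Σℤ-++ (map g (F x)) _ ⟩
    Σℤ (map g (F x)) + Σℤ (map g (concatMap F xs))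
      ≡⟨ cong (Σℤ (map g (F x)) +_) (Σℤ-concatMap F g xs) ⟩
    Σℤ (map (λ x → Σℤ (map g (F x))) (x ∷ xs)) ∎
    where open ≡-Reasoning

  Σℤ-swap : ∀ {B : Set} (T : B → A → ℤ) js xs →
            Σℤ (map (λ j → Σℤ (map (T j) xs)) js) ≡ Σℤ (map (λ x → Σℤ (map (λ j → T j x) js)) xs)
  Σℤ-swap T []       xs = sym (Σℤ-zero _ xs (λ _ → refl))
  Σℤ-swap T (j ∷ js) xs = trans (cong (Σℤ (map (T j) xs) +_) (Σℤ-swap T js xs))
                                (sym (Σℤ-+ (T j) (λ x → Σℤ (map (λ j → T j x) js)) xs))

Σℤ-applyUpTo-zero : ∀ (g : ℕ → ℤ) N → (∀ i → i < N → g i ≡ 0ℤ) → Σℤ (applyUpTo g N) ≡ 0ℤ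
Σℤ-applyUpTo-zero g zero    h = refl
Σℤ-applyUpTo-zero g (suc N) h =
  cong₂ _+_ (h 0 (s≤s z≤n)) (Σℤ-applyUpTo-zero (g ∘ suc) N (λ i i<N → h (suc i) (s≤s i<N)))

Σℤ-applyUpTo-single : ∀ (g : ℕ → ℤ) N r → r < N → (∀ i → i < N → i ≢ r → g i ≡ 0ℤ) →
                      Σℤ (applyUpTo g N) ≡ g r
Σℤ-applyUpTo-single g (suc N) zero r<N h =
  trans (cong (g 0 +_) (Σℤ-applyUpTo-zero (g ∘ suc) N (λ i i<N → h (suc i) (s≤s i<N) (λ ()))))
        (ℤP.+-identityʳ _)
Σℤ-applyUpTo-single g (suc N) (suc r) (s≤s r<N) h =
  trans (cong₂ _+_ (h 0 (s≤s z≤n) (λ ()))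
                   (Σℤ-applyUpTo-single (g ∘ suc) N r r<N
                      (λ i i<N i≢r → h (suc i) (s≤s i<N) (i≢r ∘ ℕP.suc-injective))))
        (ℤP.+-identityˡ _)

Σℤ-upTo-zero : ∀ (g : ℕ → ℤ) N → (∀ i → i < N → g i ≡ 0ℤ) → Σℤ (map g (upTo N)) ≡ 0ℤ
Σℤ-upTo-zero g N h = trans (cong Σℤ (LP.map-upTo g N)) (Σℤ-applyUpTo-zero g N h)

Σℤ-upTo-single : ∀ (g : ℕ → ℤ) N r → r < N → (∀ i → i < N → i ≢ r → g i ≡ 0ℤ) →
                 Σℤ (map g (upTo N)) ≡ g r
Σℤ-upTo-single g N r r<N h = trans (cong Σℤ (LP.map-upTo g N)) (Σℤ-applyUpTo-single g N r r<N h)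

sgn : ℕ → ℤ
sgn m = -1ℤ ^ m

sgn-+ : ∀ a b → sgn (a ℕ.+ b) ≡ sgn a * sgn b
sgn-+ = ℤP.^-distribˡ-+-* -1ℤ

sgn-suc : ∀ m → sgn (suc m) ≡ - sgn m
sgn-suc m = ℤP.-1*i≡-i (sgn m)

sgn-double : ∀ r → sgn (r ℕ.+ r) ≡ 1ℤ
sgn-double zero    = refl
sgn-double (suc r) = begin
  sgn (suc r ℕ.+ suc r)        ≡⟨ cong (sgn ∘ suc) (ℕP.+-suc r r) ⟩
  -1ℤ * (-1ℤ * sgn (r ℕ.+ r))  ≡⟨ cancel (sgn (r ℕ.+ r)) ⟩
  sgn (r ℕ.+ r)                ≡⟨ sgn-double r ⟩
  1ℤ                           ∎
  where
  open ≡-Reasoning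
  cancel : ∀ x → -1ℤ * (-1ℤ * x) ≡ x
  cancel = solve-∀

δ : ℕ → ℤ
δ zero    = 1ℤ
δ (suc _) = 0ℤ

conv : (ℕ → ℤ) → (ℕ → ℤ) → ℕ → ℤ
conv c d m = Σℤ (map (λ i → c i * d (m ∸ i)) (upTo (suc m)))

conv-congʳ : ∀ c {d d′ : ℕ → ℤ} → (∀ m → d m ≡ d′ m) → ∀ m → conv c d m ≡ conv c d′ m
conv-congʳ c eq m = Σℤ-cong (upTo (suc m)) (λ i → cong (c i *_) (eq (m ∸ i)))

conv-identityˡ : ∀ d m → conv δ d m ≡ d m
conv-identityˡ d m =
  trans (Σℤ-upTo-single (λ i → δ i * d (m ∸ i)) (suc m) 0 (s≤s z≤n)
           (λ { zero _ 0≢0 → ⊥-elim (0≢0 refl) ; (suc i) _ _ → refl }))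
        (ℤP.*-identityˡ (d m))

conv-identityʳ : ∀ c m → conv c δ m ≡ c m
conv-identityʳ c m =
  trans (Σℤ-upTo-single (λ i → c i * δ (m ∸ i)) (suc m) m ℕP.≤-refl vanish)
        (trans (cong (λ j → c m * δ j) (ℕP.n∸n≡0 m)) (ℤP.*-identityʳ (c m)))
  where
  vanish : ∀ i → i < suc m → i ≢ m → c i * δ (m ∸ i) ≡ 0ℤ
  vanish i i<1+m i≢m with m ∸ i in eq
  ... | suc _ = ℤP.*-zeroʳ (c i)
  ... | zero  = ⊥-elim (i≢m (ℕP.≤-antisym (ℕP.≤-pred i<1+m) (ℕP.m∸n≡0⇒m≤n eq)))

altGeom : ℕ → ℕ → ℤ
altGeom s j = 𝟙 (j ℕ.≤? s) * sgn j

altGeom-≤ : ∀ {s j} → j ≤ s → altGeom s j ≡ sgn j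
altGeom-≤ {s} {j} j≤s = trans (cong (_* sgn j) (𝟙-yes j≤s (j ℕ.≤? s))) (ℤP.*-identityˡ (sgn j))

altGeom-≰ : ∀ {s j} → ¬ j ≤ s → altGeom s j ≡ 0ℤ
altGeom-≰ {s} {j} j≰s = cong (_* sgn j) (𝟙-no j≰s (j ℕ.≤? s))

hCoeff : ℕ → ℕ → ℤ
hCoeff s a = 𝟙 (residue01? s a) * sgn (a ℕ.+ a % suc s)

residueTerm : ℕ → ℕ → ℕ → ℤ
residueTerm s r a = 𝟙 (a % suc s ℕ.≟ r) * sgn (a ℕ.+ a % suc s)

hCoeff-split : ∀ s a → hCoeff s a ≡ residueTerm s 0 a + residueTerm s 1 a
hCoeff-split s a =
  trans (cong (_* sgn (a ℕ.+ a % suc s))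
              (𝟙-⊎ (residue01? s a) (a % suc s ℕ.≟ 0) (a % suc s ℕ.≟ 1) (λ { (p , q) → 0≢1 (trans (sym p) q) })))
        (ℤP.*-distribʳ-+ _ (𝟙 (a % suc s ℕ.≟ 0)) _)
  where
  0≢1 : 0 ≢ 1
  0≢1 ()

module _ (S : ℕ) .{{_ : NonZero S}} where

  %-sub-residue : ∀ m r → r < S → (m ℕ.+ r ∸ m % S) % S ≡ r
  %-sub-residue m r r<S = begin
    (m ℕ.+ r ∸ m % S) % S               ≡⟨ cong (_% S) shifted ⟩
    (r ℕ.+ (m / S) ℕ.* S) % S           ≡⟨ DM.[m+kn]%n≡m%n r (m / S) S ⟩
    r % S                               ≡⟨ DM.m<n⇒m%n≡m r<S ⟩
    r                                   ∎
    where
    open ≡-Reasoning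
    shifted : m ℕ.+ r ∸ m % S ≡ r ℕ.+ (m / S) ℕ.* S
    shifted = begin
      m ℕ.+ r ∸ m % S                             ≡⟨ cong (λ x → x ℕ.+ r ∸ m % S) (DM.m≡m%n+[m/n]*n m S) ⟩
      m % S ℕ.+ (m / S) ℕ.* S ℕ.+ r ∸ m % S       ≡⟨ cong (_∸ m % S) (ℕP.+-assoc (m % S) _ r) ⟩
      m % S ℕ.+ ((m / S) ℕ.* S ℕ.+ r) ∸ m % S     ≡⟨ ℕP.m+n∸m≡n (m % S) _ ⟩
      (m / S) ℕ.* S ℕ.+ r                         ≡⟨ ℕP.+-comm _ r ⟩
      r ℕ.+ (m / S) ℕ.* S                         ∎

  %-residue-sub : ∀ m r i → i ≤ m ℕ.+ r → i < S → (m ℕ.+ r ∸ i) % S ≡ r → m % S ≡ i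
  %-residue-sub m r i i≤m+r i<S res = begin
    m % S                    ≡⟨ cong (_% S) m≡i+qS ⟩
    (i ℕ.+ q ℕ.* S) % S      ≡⟨ DM.[m+kn]%n≡m%n i q S ⟩
    i % S                    ≡⟨ DM.m<n⇒m%n≡m i<S ⟩
    i                        ∎
    where
    open ≡-Reasoning
    q : ℕ
    q = (m ℕ.+ r ∸ i) / S
    rearrange : ∀ r q i → (r ℕ.+ q) ℕ.+ i ≡ (i ℕ.+ q) ℕ.+ r
    rearrange = ℕSolver.solve-∀
    m≡i+qS : m ≡ i ℕ.+ q ℕ.* S
    m≡i+qS = ℕP.+-cancelʳ-≡ r _ _ (begin
      m ℕ.+ r                          ≡⟨ ℕP.m∸n+n≡m i≤m+r ⟨
      (m ℕ.+ r ∸ i) ℕ.+ i              ≡⟨ cong (ℕ._+ i) (DM.m≡m%n+[m/n]*n (m ℕ.+ r ∸ i) S) ⟩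
      ((m ℕ.+ r ∸ i) % S ℕ.+ q ℕ.* S) ℕ.+ i ≡⟨ cong (λ x → (x ℕ.+ q ℕ.* S) ℕ.+ i) res ⟩
      (r ℕ.+ q ℕ.* S) ℕ.+ i            ≡⟨ rearrange r (q ℕ.* S) i ⟩
      (i ℕ.+ q ℕ.* S) ℕ.+ r            ∎)

-- Only i = m mod (s+1) contributes: for i ≤ s the residue of m + r − i is r exactly then.
conv-altGeom-residueTerm : ∀ s r → r ≤ s → ∀ m → conv (altGeom s) (residueTerm s r) (m ℕ.+ r) ≡ sgn m
conv-altGeom-residueTerm s r r≤s m =
  trans (Σℤ-upTo-single (λ i → altGeom s i * residueTerm s r (m ℕ.+ r ∸ i)) (suc (m ℕ.+ r)) ρ
                        (s≤s ρ≤m+r) vanish)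
        value
  where
  S ρ : ℕ
  S = suc s
  ρ = m % S
  ρ≤m+r : ρ ≤ m ℕ.+ r
  ρ≤m+r = ℕP.≤-trans (DM.m%n≤m m S) (ℕP.m≤m+n m r)
  vanish : ∀ i → i < suc (m ℕ.+ r) → i ≢ ρ → altGeom s i * residueTerm s r (m ℕ.+ r ∸ i) ≡ 0ℤ
  vanish i i<1+m+r i≢ρ = byCases (i ℕ.≤? s)
    where
    byCases : Dec (i ≤ s) → altGeom s i * residueTerm s r (m ℕ.+ r ∸ i) ≡ 0ℤ
    byCases (no i≰s)  = trans (cong (_* residueTerm s r (m ℕ.+ r ∸ i)) (altGeom-≰ i≰s))
                              (ℤP.*-zeroˡ (residueTerm s r (m ℕ.+ r ∸ i)))
    byCases (yes i≤s) =
      trans (cong (λ z → altGeom s i * (z * sgn ((m ℕ.+ r ∸ i) ℕ.+ (m ℕ.+ r ∸ i) % S)))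
                  (𝟙-no (λ res → i≢ρ (sym (%-residue-sub S m r i (ℕP.≤-pred i<1+m+r) (s≤s i≤s) res)))
                        ((m ℕ.+ r ∸ i) % S ℕ.≟ r)))
            (ℤP.*-zeroʳ (altGeom s i))
  res : (m ℕ.+ r ∸ ρ) % S ≡ r
  res = %-sub-residue S m r (s≤s r≤s)
  value : altGeom s ρ * residueTerm s r (m ℕ.+ r ∸ ρ) ≡ sgn m
  value = begin
    altGeom s ρ * (𝟙 ((m ℕ.+ r ∸ ρ) % S ℕ.≟ r) * sgn ((m ℕ.+ r ∸ ρ) ℕ.+ (m ℕ.+ r ∸ ρ) % S))
      ≡⟨ cong₂ (λ u v → u * (v * sgn ((m ℕ.+ r ∸ ρ) ℕ.+ (m ℕ.+ r ∸ ρ) % S)))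
               (altGeom-≤ (ℕP.≤-pred (DM.m%n<n m S))) (𝟙-yes res ((m ℕ.+ r ∸ ρ) % S ℕ.≟ r)) ⟩
    sgn ρ * (1ℤ * sgn ((m ℕ.+ r ∸ ρ) ℕ.+ (m ℕ.+ r ∸ ρ) % S))
      ≡⟨ cong (λ x → sgn ρ * x) (trans (ℤP.*-identityˡ _) (cong (λ x → sgn ((m ℕ.+ r ∸ ρ) ℕ.+ x)) res)) ⟩
    sgn ρ * sgn ((m ℕ.+ r ∸ ρ) ℕ.+ r)
      ≡⟨ sgn-+ ρ _ ⟨
    sgn (ρ ℕ.+ ((m ℕ.+ r ∸ ρ) ℕ.+ r))
      ≡⟨ cong sgn (trans (sym (ℕP.+-assoc ρ _ r)) (cong (ℕ._+ r) (ℕP.m+[n∸m]≡n ρ≤m+r))) ⟩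
    sgn ((m ℕ.+ r) ℕ.+ r)
      ≡⟨ trans (cong sgn (ℕP.+-assoc m r r)) (sgn-+ m (r ℕ.+ r)) ⟩
    sgn m * sgn (r ℕ.+ r)
      ≡⟨ trans (cong (sgn m *_) (sgn-double r)) (ℤP.*-identityʳ (sgn m)) ⟩
    sgn m ∎
    where open ≡-Reasoning

conv-altGeom-hCoeff : ∀ s → 1 ≤ s → ∀ m → conv (altGeom s) (hCoeff s) m ≡ δ m
conv-altGeom-hCoeff s 1≤s zero    = refl
conv-altGeom-hCoeff s 1≤s (suc m) = begin
  conv (altGeom s) (hCoeff s) (suc m)
    ≡⟨ Σℤ-cong (upTo (suc (suc m))) (λ i → trans (cong (altGeom s i *_) (hCoeff-split s (suc m ∸ i)))
                                                  (ℤP.*-distribˡ-+ (altGeom s i) (residueTerm s 0 (suc m ∸ i)) (residueTerm s 1 (suc m ∸ i)))) ⟩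
  Σℤ (map (λ i → altGeom s i * residueTerm s 0 (suc m ∸ i) + altGeom s i * residueTerm s 1 (suc m ∸ i))
          (upTo (suc (suc m))))
    ≡⟨ Σℤ-+ (λ i → altGeom s i * residueTerm s 0 (suc m ∸ i)) (λ i → altGeom s i * residueTerm s 1 (suc m ∸ i)) (upTo (suc (suc m))) ⟩
  conv (altGeom s) (residueTerm s 0) (suc m) + conv (altGeom s) (residueTerm s 1) (suc m)
    ≡⟨ cong₂ (λ a b → conv (altGeom s) (residueTerm s 0) a + conv (altGeom s) (residueTerm s 1) b)
             (sym (ℕP.+-identityʳ (suc m))) (ℕP.+-comm 1 m) ⟩
  conv (altGeom s) (residueTerm s 0) (suc m ℕ.+ 0) + conv (altGeom s) (residueTerm s 1) (m ℕ.+ 1)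
    ≡⟨ cong₂ _+_ (conv-altGeom-residueTerm s 0 z≤n (suc m)) (conv-altGeom-residueTerm s 1 1≤s m) ⟩
  sgn (suc m) + sgn m
    ≡⟨ cong (_+ sgn m) (sgn-suc m) ⟩
  - sgn m + sgn m
    ≡⟨ ℤP.+-inverseˡ (sgn m) ⟩
  0ℤ ∎
  where open ≡-Reasoning

degree : ∀ {n} → Mon n → ℕ
degree []      = 0
degree (a ∷ e) = a ℕ.+ degree e

coordProd : ∀ {n} → (Fin n → ℕ → ℤ) → Poly n
coordProd F []      = 1ℤ
coordProd F (a ∷ e) = F zero a * coordProd (F ∘ suc) e

homPart : ∀ {n} → Poly n → PS n
homPart p k e = 𝟙 (degree e ℕ.≟ k) * p e

coordProd-cong : ∀ {n} {F G : Fin n → ℕ → ℤ} → (∀ l m → F l m ≡ G l m) → coordProd F ≗ coordProd G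
coordProd-cong eq []      = refl
coordProd-cong eq (a ∷ e) = cong₂ _*_ (eq zero a) (coordProd-cong (eq ∘ suc) e)

coordProd-δ : ∀ {n} (e : Mon n) → coordProd (λ _ → δ) e ≡ 𝟙 (degree e ℕ.≟ 0)
coordProd-δ []           = refl
coordProd-δ (zero ∷ e)   = trans (ℤP.*-identityˡ _) (coordProd-δ e)
coordProd-δ (suc _ ∷ e)  = refl

oneP-coordProd-δ : ∀ {n} → oneP {n} ≗ coordProd (λ _ → δ)
oneP-coordProd-δ []       = refl
oneP-coordProd-δ (x ∷ es) = trans (monomial-∷ 0 x _ es) (cong₂ _*_ (δ-𝟙 x) (oneP-coordProd-δ es))
  where
  δ-𝟙 : ∀ x → 𝟙 (0 ℕ.≟ x) ≡ δ x
  δ-𝟙 zero    = refl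
  δ-𝟙 (suc _) = refl

homPart-zero : ∀ {n} (C : Fin n → ℕ → ℤ) → (∀ l → C l 0 ≡ 1ℤ) → homPart (coordProd C) 0 ≗ coordProd (λ _ → δ)
homPart-zero C C0 []          = refl
homPart-zero C C0 (suc x ∷ e) = refl
homPart-zero C C0 (zero ∷ e)  = begin
  𝟙 (degree e ℕ.≟ 0) * (C zero 0 * coordProd (C ∘ suc) e)
    ≡⟨ cong (λ c → 𝟙 (degree e ℕ.≟ 0) * (c * coordProd (C ∘ suc) e)) (C0 zero) ⟩
  𝟙 (degree e ℕ.≟ 0) * (1ℤ * coordProd (C ∘ suc) e)
    ≡⟨ cong (𝟙 (degree e ℕ.≟ 0) *_) (ℤP.*-identityˡ _) ⟩
  homPart (coordProd (C ∘ suc)) 0 e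
    ≡⟨ homPart-zero (C ∘ suc) (C0 ∘ suc) e ⟩
  coordProd (λ _ → δ) e
    ≡⟨ ℤP.*-identityˡ _ ⟨
  coordProd (λ _ → δ) (zero ∷ e) ∎
  where open ≡-Reasoning

oneS-homPart : ∀ {n} k → oneS {n} k ≗ homPart (coordProd (λ _ → δ)) k
oneS-homPart zero    e = trans (oneP-coordProd-δ e) (sym (homPart-zero (λ _ → δ) (λ _ → refl) e))
oneS-homPart (suc k) e =
  sym (trans (cong (𝟙 (degree e ℕ.≟ suc k) *_) (coordProd-δ e)) (exclusive (degree e ℕ.≟ suc k) (degree e ℕ.≟ 0)))
  where
  exclusive : ∀ {d} (d₁ : Dec (d ≡ suc k)) (d₂ : Dec (d ≡ 0)) → 𝟙 d₁ * 𝟙 d₂ ≡ 0ℤ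
  exclusive (yes refl) (yes ())
  exclusive (yes _)    (no _)   = refl
  exclusive (no _)     _        = refl

mulP-cong : ∀ {n} {p p′ q q′ : Poly n} → p ≗ p′ → q ≗ q′ → mulP p q ≗ mulP p′ q′
mulP-cong eq₁ eq₂ e = Σℤ-cong (splits e) (λ { (a , b) → cong₂ _*_ (eq₁ a) (eq₂ b) })

mulP-identityˡ : ∀ {n} (q : Poly n) → mulP oneP q ≗ q
mulP-identityˡ q e = trans (mulP-cong oneP-coordProd-δ (λ _ → refl) e) (unit q e)
  where
  unit : ∀ {n} (q : Poly n) → mulP (coordProd (λ _ → δ)) q ≗ q
  unit q []       = trans (ℤP.+-identityʳ _) (ℤP.*-identityˡ _)
  unit q (x ∷ es) = begin
    mulP (coordProd (λ _ → δ)) q (x ∷ es)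
      ≡⟨ Σℤ-concatMap (λ i → map (prepend i) (splits es)) T (upTo (suc x)) ⟩
    Σℤ (map (λ i → Σℤ (map T (map (prepend i) (splits es)))) (upTo (suc x)))
      ≡⟨ Σℤ-upTo-single (λ i → Σℤ (map T (map (prepend i) (splits es)))) (suc x) 0 (s≤s z≤n) vanish ⟩
    Σℤ (map T (map (prepend 0) (splits es)))
      ≡⟨ Σℤ-map-∘ T (prepend 0) (splits es) ⟩
    Σℤ (map (T ∘ prepend 0) (splits es))
      ≡⟨ Σℤ-cong (splits es) (λ { (a , b) → cong (_* q (x ∷ b)) (ℤP.*-identityˡ (coordProd (λ _ → δ) a)) }) ⟩
    mulP (coordProd (λ _ → δ)) (λ b → q (x ∷ b)) es
      ≡⟨ unit (λ b → q (x ∷ b)) es ⟩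
    q (x ∷ es) ∎
    where
    open ≡-Reasoning
    T : _ → ℤ
    T (a , b) = coordProd (λ _ → δ) a * q b
    prepend : ℕ → _ → _
    prepend i (a , b) = (i ∷ a , (x ∸ i) ∷ b)
    vanish : ∀ i → i < suc x → i ≢ 0 → Σℤ (map T (map (prepend i) (splits es))) ≡ 0ℤ
    vanish zero    _ 0≢0 = ⊥-elim (0≢0 refl)
    vanish (suc i) _ _   = trans (Σℤ-map-∘ T (prepend (suc i)) (splits es))
                                 (Σℤ-zero (T ∘ prepend (suc i)) (splits es) (λ _ → refl))

mulP-coordProd : ∀ {n} (F G : Fin n → ℕ → ℤ) →
                 mulP (coordProd F) (coordProd G) ≗ coordProd (λ l → conv (F l) (G l))
mulP-coordProd F G []       = refl
mulP-coordProd F G (x ∷ es) = begin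
  mulP (coordProd F) (coordProd G) (x ∷ es)
    ≡⟨ Σℤ-concatMap (λ i → map (prepend i) (splits es)) T (upTo (suc x)) ⟩
  Σℤ (map (λ i → Σℤ (map T (map (prepend i) (splits es)))) (upTo (suc x)))
    ≡⟨ Σℤ-cong (upTo (suc x)) factorOut ⟩
  Σℤ (map (λ i → rest * (F zero i * G zero (x ∸ i))) (upTo (suc x)))
    ≡⟨ Σℤ-*ˡ rest (λ i → F zero i * G zero (x ∸ i)) (upTo (suc x)) ⟩
  rest * conv (F zero) (G zero) x
    ≡⟨ ℤP.*-comm rest (conv (F zero) (G zero) x) ⟩
  coordProd (λ l → conv (F l) (G l)) (x ∷ es) ∎
  where
  open ≡-Reasoning
  rest : ℤ
  rest = coordProd (λ l → conv (F (suc l)) (G (suc l))) es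
  T : _ → ℤ
  T (a , b) = coordProd F a * coordProd G b
  prepend : ℕ → _ → _
  prepend i (a , b) = (i ∷ a , (x ∸ i) ∷ b)
  interchange : ∀ a b c d → (a * b) * (c * d) ≡ (a * c) * (b * d)
  interchange = solve-∀
  factorOut : ∀ i → Σℤ (map T (map (prepend i) (splits es))) ≡ rest * (F zero i * G zero (x ∸ i))
  factorOut i = begin
    Σℤ (map T (map (prepend i) (splits es)))
      ≡⟨ Σℤ-map-∘ T (prepend i) (splits es) ⟩
    Σℤ (map (T ∘ prepend i) (splits es))
      ≡⟨ Σℤ-cong (splits es) (λ { (a , b) → interchange (F zero i) (coordProd (F ∘ suc) a)
                                                         (G zero (x ∸ i)) (coordProd (G ∘ suc) b) }) ⟩
    Σℤ (map (λ ab → (F zero i * G zero (x ∸ i)) * T′ ab) (splits es))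
      ≡⟨ Σℤ-*ˡ (F zero i * G zero (x ∸ i)) T′ (splits es) ⟩
    (F zero i * G zero (x ∸ i)) * mulP (coordProd (F ∘ suc)) (coordProd (G ∘ suc)) es
      ≡⟨ cong ((F zero i * G zero (x ∸ i)) *_) (mulP-coordProd (F ∘ suc) (G ∘ suc) es) ⟩
    (F zero i * G zero (x ∸ i)) * rest
      ≡⟨ ℤP.*-comm _ rest ⟩
    rest * (F zero i * G zero (x ∸ i)) ∎
    where
    T′ : _ → ℤ
    T′ (a , b) = coordProd (F ∘ suc) a * coordProd (G ∘ suc) b

splits-degree : ∀ {n} (e : Mon n) → All (λ ab → degree (proj₁ ab) ℕ.+ degree (proj₂ ab) ≡ degree e) (splits e)
splits-degree []       = refl ∷ []
splits-degree (x ∷ es) =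
  AllP.concat⁺ (AllP.map⁺ (AllP.applyUpTo⁺₁ (λ i → i) (suc x) λ {i} i<1+x →
    AllP.map⁺ (All.map (λ {ab} ok → trans (interchange i (degree (proj₁ ab)) (x ∸ i) (degree (proj₂ ab)))
                                          (cong₂ ℕ._+_ (ℕP.m+[n∸m]≡n (ℕP.≤-pred i<1+x)) ok))
                       (splits-degree es))))
  where
  interchange : ∀ a b c d → (a ℕ.+ b) ℕ.+ (c ℕ.+ d) ≡ (a ℕ.+ c) ℕ.+ (b ℕ.+ d)
  interchange = ℕSolver.solve-∀

Σℤ-degreeSplit : ∀ (A B : ℤ) (da db de k : ℕ) → da ℕ.+ db ≡ de →
  Σℤ (map (λ j → (𝟙 (da ℕ.≟ j) * A) * (𝟙 (db ℕ.≟ k ∸ j) * B)) (upTo (suc k))) ≡ 𝟙 (de ℕ.≟ k) * (A * B)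
Σℤ-degreeSplit A B da db de k da+db≡de with de ℕ.≟ k
... | no de≢k = Σℤ-upTo-zero _ (suc k) λ i i<1+k → vanish i (ℕP.≤-pred i<1+k) (da ℕ.≟ i) (db ℕ.≟ k ∸ i)
  where
  vanish : ∀ i → i ≤ k → (d₁ : Dec (da ≡ i)) (d₂ : Dec (db ≡ k ∸ i)) → (𝟙 d₁ * A) * (𝟙 d₂ * B) ≡ 0ℤ
  vanish i i≤k (no _)      d₂         = refl
  vanish i i≤k (yes _)     (no _)     = ℤP.*-zeroʳ (1ℤ * A)
  vanish i i≤k (yes refl)  (yes refl) = ⊥-elim (de≢k (trans (sym da+db≡de) (ℕP.m+[n∸m]≡n i≤k)))
... | yes de≡k = begin
  Σℤ (map (λ j → (𝟙 (da ℕ.≟ j) * A) * (𝟙 (db ℕ.≟ k ∸ j) * B)) (upTo (suc k)))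
    ≡⟨ Σℤ-upTo-single _ (suc k) da (s≤s da≤k) vanish ⟩
  (𝟙 (da ℕ.≟ da) * A) * (𝟙 (db ℕ.≟ k ∸ da) * B)
    ≡⟨ cong₂ (λ u v → (u * A) * (v * B)) (𝟙-yes refl (da ℕ.≟ da)) (𝟙-yes db≡k∸da (db ℕ.≟ k ∸ da)) ⟩
  (1ℤ * A) * (1ℤ * B)
    ≡⟨ cong₂ _*_ (ℤP.*-identityˡ A) (ℤP.*-identityˡ B) ⟩
  A * B
    ≡⟨ ℤP.*-identityˡ (A * B) ⟨
  1ℤ * (A * B) ∎
  where
  open ≡-Reasoning
  da+db≡k : da ℕ.+ db ≡ k
  da+db≡k = trans da+db≡de de≡k
  da≤k : da ≤ k
  da≤k = subst (da ≤_) da+db≡k (ℕP.m≤m+n da db)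
  db≡k∸da : db ≡ k ∸ da
  db≡k∸da = sym (trans (cong (_∸ da) (sym da+db≡k)) (ℕP.m+n∸m≡n da db))
  vanish : ∀ i → i < suc k → i ≢ da → (𝟙 (da ℕ.≟ i) * A) * (𝟙 (db ℕ.≟ k ∸ i) * B) ≡ 0ℤ
  vanish i _ i≢da = cong (λ z → (z * A) * (𝟙 (db ℕ.≟ k ∸ i) * B)) (𝟙-no (i≢da ∘ sym) (da ℕ.≟ i))

mulS-homPart : ∀ {n} (f g : PS n) (A B : Poly n) → (∀ j → f j ≗ homPart A j) → (∀ j → g j ≗ homPart B j) →
               ∀ k → mulS f g k ≗ homPart (mulP A B) k
mulS-homPart f g A B f≗A g≗B k e = begin
  mulS f g k e
    ≡⟨ Σℤ-cong (upTo (suc k)) (λ j → mulP-cong (f≗A j) (g≗B (k ∸ j)) e) ⟩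
  Σℤ (map (λ j → Σℤ (map (T j) (splits e))) (upTo (suc k)))
    ≡⟨ Σℤ-swap T (upTo (suc k)) (splits e) ⟩
  Σℤ (map (λ ab → Σℤ (map (λ j → T j ab) (upTo (suc k)))) (splits e))
    ≡⟨ Σℤ-congᴬ (splits-degree e) (λ {ab} → Σℤ-degreeSplit (A (proj₁ ab)) (B (proj₂ ab))
                                              (degree (proj₁ ab)) (degree (proj₂ ab)) (degree e) k) ⟩
  Σℤ (map (λ ab → 𝟙 (degree e ℕ.≟ k) * (A (proj₁ ab) * B (proj₂ ab))) (splits e))
    ≡⟨ Σℤ-*ˡ (𝟙 (degree e ℕ.≟ k)) (λ ab → A (proj₁ ab) * B (proj₂ ab)) (splits e) ⟩
  homPart (mulP A B) k e ∎
  where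
  open ≡-Reasoning
  T : ℕ → _ → ℤ
  T j (a , b) = homPart A j a * homPart B (k ∸ j) b

atCoord : ∀ {n} → (ℕ → ℤ) → Fin n → Fin n → ℕ → ℤ
atCoord g zero    zero    = g
atCoord g zero    (suc _) = δ
atCoord g (suc _) zero    = δ
atCoord g (suc i) (suc l) = atCoord g i l

monomial-powVec : ∀ {n} (g : ℕ → ℤ) (i : Fin n) j →
                  (λ e → monomial (powVec i j) e * g j) ≗ homPart (coordProd (atCoord g i)) j
monomial-powVec g zero j (a ∷ as) = begin
  monomial (j ∷ V.replicate _ 0) (a ∷ as) * g j
    ≡⟨ cong (_* g j) (monomial-∷ j a _ as) ⟩
  (𝟙 (j ℕ.≟ a) * oneP as) * g j
    ≡⟨ cong (λ z → (𝟙 (j ℕ.≟ a) * z) * g j) (trans (oneP-coordProd-δ as) (coordProd-δ as)) ⟩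
  (𝟙 (j ℕ.≟ a) * 𝟙 (degree as ℕ.≟ 0)) * g j
    ≡⟨ concentrate (j ℕ.≟ a) (degree as ℕ.≟ 0) (a ℕ.+ degree as ℕ.≟ j) ⟩
  𝟙 (a ℕ.+ degree as ℕ.≟ j) * (g a * 𝟙 (degree as ℕ.≟ 0))
    ≡⟨ cong (λ z → 𝟙 (a ℕ.+ degree as ℕ.≟ j) * (g a * z)) (coordProd-δ as) ⟨
  homPart (coordProd (atCoord g zero)) j (a ∷ as) ∎
  where
  open ≡-Reasoning
  concentrate : ∀ {d} (d₁ : Dec (j ≡ a)) (d₂ : Dec (d ≡ 0)) (d₃ : Dec (a ℕ.+ d ≡ j)) →
                (𝟙 d₁ * 𝟙 d₂) * g j ≡ 𝟙 d₃ * (g a * 𝟙 d₂)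
  concentrate (yes refl) (yes refl) d₃ =
    trans (ℤP.*-identityˡ (g j))
          (sym (trans (cong (_* (g j * 1ℤ)) (𝟙-yes (ℕP.+-identityʳ j) d₃))
                      (trans (ℤP.*-identityˡ _) (ℤP.*-identityʳ (g j)))))
  concentrate (no j≢a) (yes refl) d₃ =
    sym (cong (_* (g a * 1ℤ)) (𝟙-no (λ a+0≡j → j≢a (trans (sym a+0≡j) (ℕP.+-identityʳ a))) d₃))
  concentrate d₁ (no _) d₃ =
    trans (cong (_* g j) (ℤP.*-zeroʳ (𝟙 d₁)))
          (sym (trans (cong (𝟙 d₃ *_) (ℤP.*-zeroʳ (g a))) (ℤP.*-zeroʳ (𝟙 d₃))))
monomial-powVec g (suc i) j (zero ∷ as) = begin
  monomial (0 ∷ powVec i j) (0 ∷ as) * g j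
    ≡⟨ cong (_* g j) (trans (monomial-∷ 0 0 (powVec i j) as) (ℤP.*-identityˡ _)) ⟩
  monomial (powVec i j) as * g j
    ≡⟨ monomial-powVec g i j as ⟩
  𝟙 (degree as ℕ.≟ j) * coordProd (atCoord g i) as
    ≡⟨ cong (𝟙 (degree as ℕ.≟ j) *_) (ℤP.*-identityˡ _) ⟨
  homPart (coordProd (atCoord g (suc i))) j (zero ∷ as) ∎
  where open ≡-Reasoning
monomial-powVec g (suc i) j (suc a ∷ as) =
  trans (cong (_* g j) (monomial-∷ 0 (suc a) (powVec i j) as))
        (sym (ℤP.*-zeroʳ (𝟙 (suc a ℕ.+ degree as ℕ.≟ j))))

factor-homPart : ∀ {n} s (i : Fin n) j → factor s i j ≗ homPart (coordProd (atCoord (altGeom s) i)) j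
factor-homPart s i j e = trans asProduct (monomial-powVec (altGeom s) i j e)
  where
  m : ℤ
  m = monomial (powVec i j) e
  asProduct : factor s i j e ≡ m * altGeom s j
  -- the `with` also abstracts the test j ≤? s inside altGeom s j
  asProduct with j ℕ.≤? s
  ... | yes _ = trans (ℤP.*-comm (sgn j) m) (cong (m *_) (sym (ℤP.*-identityˡ (sgn j))))
  ... | no _  = sym (trans (cong (m *_) (ℤP.*-zeroˡ (sgn j))) (ℤP.*-zeroʳ m))

convAtCoords : ∀ {n} → (ℕ → ℤ) → List (Fin n) → Fin n → ℕ → ℤ
convAtCoords g []      l = δ
convAtCoords g (i ∷ L) l = conv (atCoord g i l) (convAtCoords g L l)

foldr-factor-homPart : ∀ {n} s (L : List (Fin n)) k →
  foldr (λ i acc → mulS (factor s i) acc) oneS L k ≗ homPart (coordProd (convAtCoords (altGeom s) L)) k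
foldr-factor-homPart s []      k e = oneS-homPart k e
foldr-factor-homPart s (i ∷ L) k e =
  trans (mulS-homPart (factor s i) _ _ _ (factor-homPart s i) (foldr-factor-homPart s L) k e)
        (cong (𝟙 (degree e ℕ.≟ k) *_) (mulP-coordProd (atCoord (altGeom s) i) (convAtCoords (altGeom s) L) e))

convAtCoords-allFin : ∀ n g (l : Fin n) m → convAtCoords g (toList (allFin n)) l m ≡ g m
convAtCoords-allFin (suc n) g l m =
  trans (cong (λ L → convAtCoords g L l m) (trans (cong toList (VP.allFin-map n)) (cong (zero ∷_) (VP.toList-map suc (allFin n)))))
        (split l)
  where
  L : List (Fin n)
  L = toList (allFin n)
  atZero : ∀ (L : List (Fin n)) m → convAtCoords g (map suc L) zero m ≡ δ m
  atZero []      m = refl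
  atZero (i ∷ L) m = trans (conv-congʳ δ (atZero L) m) (conv-identityˡ δ m)
  atSuc : ∀ (L : List (Fin n)) l m → convAtCoords g (map suc L) (suc l) m ≡ convAtCoords g L l m
  atSuc []      l m = refl
  atSuc (i ∷ L) l m = conv-congʳ (atCoord g i l) (atSuc L l) m
  split : ∀ l → convAtCoords g (zero ∷ map suc L) l m ≡ g m
  split zero    = trans (conv-congʳ g (atZero L) m) (conv-identityʳ g m)
  split (suc l) = trans (conv-identityˡ (convAtCoords g (map suc L) (suc l)) m)
                        (trans (atSuc L l m) (convAtCoords-allFin n g l m))

factorProduct-homPart : ∀ s n k → factorProduct s n k ≗ homPart (coordProd (λ _ → altGeom s)) k
factorProduct-homPart s n k e =
  trans (foldr-factor-homPart s (toList (allFin n)) k e)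
        (cong (𝟙 (degree e ℕ.≟ k) *_) (coordProd-cong (convAtCoords-allFin n (altGeom s)) e))

invPrefix-upTo : ∀ {n} (f : PS n) k → invPrefix f k ≡ map (λ j → invS f (k ∸ j)) (upTo (suc k))
invPrefix-upTo f zero    = refl
invPrefix-upTo f (suc k) = cong (invS f (suc k) ∷_) (begin
  invPrefix f k                                              ≡⟨ invPrefix-upTo f k ⟩
  map (λ j → invS f (k ∸ j)) (upTo (suc k))                  ≡⟨ LP.map-upTo _ (suc k) ⟩
  applyUpTo (λ j → invS f (k ∸ j)) (suc k)                   ≡⟨ LP.map-applyUpTo suc _ (suc k) ⟨
  map (λ j → invS f (suc k ∸ j)) (applyUpTo suc (suc k))     ∎)
  where open ≡-Reasoning

foldr-addP : ∀ {n} (ps : List (Poly n)) e → foldr addP zeroP ps e ≡ Σℤ (map (λ p → p e) ps)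
foldr-addP []       e = refl
foldr-addP (p ∷ ps) e = cong (p e +_) (foldr-addP ps e)

zipWith-map-diagonal : ∀ {A B C D : Set} (h : B → C → D) (u : A → B) (v : A → C) xs →
              zipWith h (map u xs) (map v xs) ≡ map (λ x → h (u x) (v x)) xs
zipWith-map-diagonal h u v []       = refl
zipWith-map-diagonal h u v (x ∷ xs) = cong (h (u x) (v x) ∷_) (zipWith-map-diagonal h u v xs)

invS-suc : ∀ {n} (f : PS n) k e →
           invS f (suc k) e ≡ - Σℤ (map (λ j → mulP (f (suc j)) (invS f (k ∸ j)) e) (upTo (suc k)))
invS-suc f k e = cong -_ (begin
  foldr addP zeroP (zipWith (λ j g → mulP (f j) g) (map suc (upTo (suc k))) (invPrefix f k)) e
    ≡⟨ foldr-addP (zipWith (λ j g → mulP (f j) g) (map suc (upTo (suc k))) (invPrefix f k)) e ⟩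
  Σℤ (map (λ p → p e) (zipWith (λ j g → mulP (f j) g) (map suc (upTo (suc k))) (invPrefix f k)))
    ≡⟨ cong (λ ps → Σℤ (map (λ p → p e) (zipWith (λ j g → mulP (f j) g) (map suc (upTo (suc k))) ps)))
            (invPrefix-upTo f k) ⟩
  Σℤ (map (λ p → p e) (zipWith (λ j g → mulP (f j) g) (map suc (upTo (suc k)))
                                (map (λ j → invS f (k ∸ j)) (upTo (suc k)))))
    ≡⟨ cong (λ ps → Σℤ (map (λ p → p e) ps))
            (zipWith-map-diagonal (λ j g → mulP (f j) g) suc (λ j → invS f (k ∸ j)) (upTo (suc k))) ⟩
  Σℤ (map (λ p → p e) (map (λ j → mulP (f (suc j)) (invS f (k ∸ j))) (upTo (suc k))))
    ≡⟨ Σℤ-map-∘ (λ p → p e) (λ j → mulP (f (suc j)) (invS f (k ∸ j))) (upTo (suc k)) ⟩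
  Σℤ (map (λ j → mulP (f (suc j)) (invS f (k ∸ j)) e) (upTo (suc k))) ∎)
  where open ≡-Reasoning

mulS-suc : ∀ {n} (f g : PS n) k e →
           mulS f g (suc k) e ≡ mulP (f 0) (g (suc k)) e + Σℤ (map (λ j → mulP (f (suc j)) (g (k ∸ j)) e) (upTo (suc k)))
mulS-suc f g k e = cong (mulP (f 0) (g (suc k)) e +_) (cong Σℤ (begin
  map (λ j → mulP (f j) (g (suc k ∸ j)) e) (applyUpTo suc (suc k))  ≡⟨ LP.map-applyUpTo suc _ (suc k) ⟩
  applyUpTo (λ j → mulP (f (suc j)) (g (k ∸ j)) e) (suc k)          ≡⟨ LP.map-upTo _ (suc k) ⟨
  map (λ j → mulP (f (suc j)) (g (k ∸ j)) e) (upTo (suc k))         ∎))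
  where open ≡-Reasoning

invS-unique : ∀ {n} (f g : PS n) → f 0 ≗ oneP → (∀ k → mulS f g k ≗ oneS k) → ∀ k → invS f k ≗ g k
invS-unique f g f₀≗1 fg≗1 k = agree k k ℕP.≤-refl
  where
  agree : ∀ k j → j ≤ k → invS f j ≗ g j
  agree zero    zero    z≤n e = sym (begin
    g 0 e                         ≡⟨ mulP-identityˡ (g 0) e ⟨
    mulP oneP (g 0) e             ≡⟨ mulP-cong f₀≗1 (λ _ → refl) e ⟨
    mulP (f 0) (g 0) e            ≡⟨ ℤP.+-identityʳ _ ⟨
    mulS f g 0 e                  ≡⟨ fg≗1 0 e ⟩
    oneP e                        ∎)
    where open ≡-Reasoning
  agree (suc k) j j≤1+k e with j ℕ.≟ suc k
  ... | no j≢1+k = agree k j (ℕP.≤-pred (ℕP.≤∧≢⇒< j≤1+k j≢1+k)) e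
  ... | yes refl = begin
    invS f (suc k) e
      ≡⟨ invS-suc f k e ⟩
    - Σℤ (map (λ j → mulP (f (suc j)) (invS f (k ∸ j)) e) (upTo (suc k)))
      ≡⟨ cong -_ (Σℤ-cong (upTo (suc k)) (λ j → mulP-cong {p = f (suc j)} (λ _ → refl) (agree k (k ∸ j) (ℕP.m∸n≤m k j)) e)) ⟩
    - Σℤ (map (λ j → mulP (f (suc j)) (g (k ∸ j)) e) (upTo (suc k)))
      ≡⟨ inverseˡ-unique (g (suc k) e) rest g+rest≡0 ⟨
    g (suc k) e ∎
    where
    open ≡-Reasoning
    rest : ℤ
    rest = Σℤ (map (λ j → mulP (f (suc j)) (g (k ∸ j)) e) (upTo (suc k)))
    g+rest≡0 : g (suc k) e + rest ≡ 0ℤ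
    g+rest≡0 = begin
      g (suc k) e + rest                    ≡⟨ cong (_+ rest) (mulP-identityˡ (g (suc k)) e) ⟨
      mulP oneP (g (suc k)) e + rest        ≡⟨ cong (_+ rest) (mulP-cong f₀≗1 (λ _ → refl) e) ⟨
      mulP (f 0) (g (suc k)) e + rest       ≡⟨ mulS-suc f g k e ⟨
      mulS f g (suc k) e                    ≡⟨ fg≗1 (suc k) e ⟩
      0ℤ                                    ∎

Ascending Descending : List ℕ → Set
Ascending  = Linked _≤_
Descending = Linked (λ x y → y ≤ x)

≥-decTotalOrder : DecTotalOrder 0ℓ 0ℓ 0ℓ
≥-decTotalOrder = DecTotalOrderP.≥-decTotalOrder ℕP.≤-decTotalOrder

sortDesc : List ℕ → List ℕ
sortDesc = ISort.sort ≥-decTotalOrder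

ascending-↭⇒≡ : ∀ {xs ys} → Ascending xs → Ascending ys → xs ↭ ys → xs ≡ ys
ascending-↭⇒≡ p q r = Pointwise.Pointwise-≡⇒≡ (SortedP.↗↭↗⇒≋ ℕP.≤-totalOrder p q (↭⇒↭ₛ r))

descending-↭⇒≡ : ∀ {xs ys} → Descending xs → Descending ys → xs ↭ ys → xs ≡ ys
descending-↭⇒≡ p q r =
  Pointwise.Pointwise-≡⇒≡ (SortedP.↗↭↗⇒≋ (DecTotalOrderP.≥-totalOrder ℕP.≤-decTotalOrder) p q (↭⇒↭ₛ r))

sortℕ≡⇒≡sortDesc : ∀ μ l → Descending l → sortℕ μ ≡ sortℕ l → l ≡ sortDesc μ
sortℕ≡⇒≡sortDesc μ l l↘ eq = descending-↭⇒≡ l↘ (ISortP.sort-↗ ≥-decTotalOrder μ) (begin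
  l          ↭⟨ ISortP.sort-↭ ℕP.≤-decTotalOrder l ⟨
  sortℕ l    ≡⟨ eq ⟨
  sortℕ μ    ↭⟨ ISortP.sort-↭ ℕP.≤-decTotalOrder μ ⟩
  μ          ↭⟨ ISortP.sort-↭ ≥-decTotalOrder μ ⟨
  sortDesc μ ∎)
  where open PermutationReasoning

≡sortDesc⇒sortℕ≡ : ∀ μ l → l ≡ sortDesc μ → sortℕ μ ≡ sortℕ l
≡sortDesc⇒sortℕ≡ μ l refl =
  ascending-↭⇒≡ (ISortP.sort-↗ ℕP.≤-decTotalOrder μ) (ISortP.sort-↗ ℕP.≤-decTotalOrder (sortDesc μ)) (begin
  sortℕ μ              ↭⟨ ISortP.sort-↭ ℕP.≤-decTotalOrder μ ⟩
  μ                    ↭⟨ ISortP.sort-↭ ≥-decTotalOrder μ ⟨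
  sortDesc μ           ↭⟨ ISortP.sort-↭ ℕP.≤-decTotalOrder (sortDesc μ) ⟨
  sortℕ (sortDesc μ)   ∎)
  where open PermutationReasoning

shape : ∀ {n} → Mon n → List ℕ
shape e = sortDesc (nonzeroEntries e)

monomialSym-descending : ∀ {n} l (e : Mon n) → Descending l →
                         monomialSym l e ≡ 𝟙 (LP.≡-dec ℕ._≟_ l (shape e))
monomialSym-descending l e l↘ = trans asIndicator
  (𝟙-⇔ (sortℕ≡⇒≡sortDesc μ l l↘) (≡sortDesc⇒sortℕ≡ μ l) _ (LP.≡-dec ℕ._≟_ l (sortDesc μ)))
  where
  μ : List ℕ
  μ = nonzeroEntries e
  asIndicator : monomialSym l e ≡ 𝟙 (LP.≡-dec ℕ._≟_ (sortℕ μ) (sortℕ l))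
  asIndicator with LP.≡-dec ℕ._≟_ (sortℕ μ) (sortℕ l)
  ... | yes _ = refl
  ... | no _  = refl

Positive : List ℕ → Set
Positive = All (λ a → a ≢ 0)

Partition : ℕ → ℕ → List ℕ → Set
Partition m k l = Descending l × All (_≤ m) l × sum l ≡ k

descending-cons : ∀ {p l} → Descending l → All (_≤ p) l → Descending (p ∷ l)
descending-cons {l = []}    _  _           = [-]
descending-cons {l = _ ∷ _} l↘ (x≤p ∷ _) = x≤p ∷ l↘

descending-head : ∀ {q l} → Descending (q ∷ l) → All (_≤ q) l
descending-head [-]          = []
descending-head (x≤q ∷ l↘) = x≤q ∷ All.map (λ y≤x → ℕP.≤-trans y≤x x≤q) (descending-head l↘)

descending-tail : ∀ {q l} → Descending (q ∷ l) → Descending l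
descending-tail [-]      = []
descending-tail (_ ∷ l↘) = l↘

partitionsBounded-partition : ∀ f k m → All (Partition m k) (partitionsBounded f k m)
partitionsBounded-partition f       zero    m = ([] , [] , refl) ∷ []
partitionsBounded-partition zero    (suc k) m = []
partitionsBounded-partition (suc f) (suc k) m =
  AllP.concat⁺ (AllP.map⁺ (AllP.map⁺ (AllP.applyUpTo⁺₁ (λ i → i) (suc k ⊓ m) λ {i} i<N →
    AllP.map⁺ (All.map (extend i<N) (partitionsBounded-partition f (suc k ∸ suc i) (suc i))))))
  where
  extend : ∀ {i l} → i < suc k ⊓ m → Partition (suc i) (suc k ∸ suc i) l → Partition m (suc k) (suc i ∷ l)
  extend {i} i<N (l↘ , l≤ , Σl) =
    descending-cons l↘ l≤ ,
    (p≤m ∷ All.map (λ a≤p → ℕP.≤-trans a≤p p≤m) l≤) ,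
    trans (cong (suc i ℕ.+_) Σl) (ℕP.m+[n∸m]≡n (ℕP.≤-trans i<N (ℕP.m⊓n≤m (suc k) m)))
    where
    p≤m : suc i ≤ m
    p≤m = ℕP.≤-trans i<N (ℕP.m⊓n≤n (suc k) m)

Σℤ-cons-select : ∀ p q ν (w : List ℕ → ℤ) ls →
  Σℤ (map (λ l → 𝟙 (LP.≡-dec ℕ._≟_ l (q ∷ ν)) * w l) (map (p ∷_) ls))
    ≡ 𝟙 (p ℕ.≟ q) * Σℤ (map (λ l → 𝟙 (LP.≡-dec ℕ._≟_ l ν) * w (p ∷ l)) ls)
Σℤ-cons-select p q ν w ls = begin
  Σℤ (map (λ l → 𝟙 (LP.≡-dec ℕ._≟_ l (q ∷ ν)) * w l) (map (p ∷_) ls))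
    ≡⟨ Σℤ-map-∘ _ (p ∷_) ls ⟩
  Σℤ (map (λ l → 𝟙 (LP.≡-dec ℕ._≟_ (p ∷ l) (q ∷ ν)) * w (p ∷ l)) ls)
    ≡⟨ Σℤ-cong ls (λ l → trans (cong (_* w (p ∷ l)) (𝟙-× (LP.≡-dec ℕ._≟_ (p ∷ l) (q ∷ ν)) (p ℕ.≟ q)
                                                          (LP.≡-dec ℕ._≟_ l ν) LP.∷-injective (cong₂ _∷_)))
                               (ℤP.*-assoc (𝟙 (p ℕ.≟ q)) _ (w (p ∷ l)))) ⟩
  Σℤ (map (λ l → 𝟙 (p ℕ.≟ q) * (𝟙 (LP.≡-dec ℕ._≟_ l ν) * w (p ∷ l))) ls)
    ≡⟨ Σℤ-*ˡ (𝟙 (p ℕ.≟ q)) (λ l → 𝟙 (LP.≡-dec ℕ._≟_ l ν) * w (p ∷ l)) ls ⟩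
  𝟙 (p ℕ.≟ q) * Σℤ (map (λ l → 𝟙 (LP.≡-dec ℕ._≟_ l ν) * w (p ∷ l)) ls) ∎
  where open ≡-Reasoning

Σℤ-partitionsBounded-select : ∀ f k m ν (w : List ℕ → ℤ) → k ≤ f → Descending ν → Positive ν → All (_≤ m) ν →
  Σℤ (map (λ l → 𝟙 (LP.≡-dec ℕ._≟_ l ν) * w l) (partitionsBounded f k m)) ≡ 𝟙 (sum ν ℕ.≟ k) * w ν
Σℤ-partitionsBounded-select f zero m [] w _ _ _ _ = ℤP.+-identityʳ _
Σℤ-partitionsBounded-select f zero m (q ∷ ν) w _ _ (q≢0 ∷ _) _ =
  sym (cong (_* w (q ∷ ν)) (𝟙-no (q≢0 ∘ ℕP.m+n≡0⇒m≡0 q) (sum (q ∷ ν) ℕ.≟ 0)))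
Σℤ-partitionsBounded-select zero (suc k) m ν w () _ _ _
Σℤ-partitionsBounded-select (suc f) (suc k) m [] w _ _ _ _ =
  trans (Σℤ-concatMap (λ p → map (p ∷_) (partitionsBounded f (suc k ∸ p) p)) T (map suc (upTo (suc k ⊓ m))))
        (Σℤ-zero _ (map suc (upTo (suc k ⊓ m)))
           (λ p → trans (Σℤ-map-∘ T (p ∷_) (partitionsBounded f (suc k ∸ p) p))
                        (Σℤ-zero (T ∘ (p ∷_)) (partitionsBounded f (suc k ∸ p) p) (λ _ → refl))))
  where
  T : List ℕ → ℤ
  T l = 𝟙 (LP.≡-dec ℕ._≟_ l []) * w l
Σℤ-partitionsBounded-select (suc f) (suc k) m (zero ∷ ν) w _ _ (0≢0 ∷ _) _ = ⊥-elim (0≢0 refl)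
Σℤ-partitionsBounded-select (suc f) (suc k) m (suc r ∷ ν) w k<1+f ν↘ (_ ∷ ν⁺) (q≤m ∷ _) = begin
  Σℤ (map T (concatMap (λ p → map (p ∷_) (tails p)) (map suc (upTo N))))
    ≡⟨ Σℤ-concatMap (λ p → map (p ∷_) (tails p)) T (map suc (upTo N)) ⟩
  Σℤ (map (λ p → Σℤ (map T (map (p ∷_) (tails p)))) (map suc (upTo N)))
    ≡⟨ Σℤ-cong (map suc (upTo N)) (λ p → Σℤ-cons-select p q ν w (tails p)) ⟩
  Σℤ (map (λ p → 𝟙 (p ℕ.≟ q) * X p) (map suc (upTo N)))
    ≡⟨ Σℤ-map-∘ (λ p → 𝟙 (p ℕ.≟ q) * X p) suc (upTo N) ⟩
  Σℤ (map (λ i → 𝟙 (suc i ℕ.≟ q) * X (suc i)) (upTo N))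
    ≡⟨ selectHead (q ℕ.≤? suc k) ⟩
  𝟙 (q ℕ.+ sum ν ℕ.≟ suc k) * w (q ∷ ν) ∎
  where
  open ≡-Reasoning
  q N : ℕ
  q = suc r
  N = suc k ⊓ m
  tails : ℕ → List (List ℕ)
  tails p = partitionsBounded f (suc k ∸ p) p
  T : List ℕ → ℤ
  T l = 𝟙 (LP.≡-dec ℕ._≟_ l (q ∷ ν)) * w l
  X : ℕ → ℤ
  X p = Σℤ (map (λ l → 𝟙 (LP.≡-dec ℕ._≟_ l ν) * w (p ∷ l)) (tails p))
  selectHead : Dec (q ≤ suc k) →
    Σℤ (map (λ i → 𝟙 (suc i ℕ.≟ q) * X (suc i)) (upTo N)) ≡ 𝟙 (q ℕ.+ sum ν ℕ.≟ suc k) * w (q ∷ ν)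
  selectHead (no q≰1+k) =
    trans (Σℤ-upTo-zero _ N (λ i i<N → cong (_* X (suc i))
             (𝟙-no (λ i+1≡q → q≰1+k (subst (_≤ suc k) i+1≡q (ℕP.≤-trans i<N (ℕP.m⊓n≤m (suc k) m))))
                   (suc i ℕ.≟ q))))
          (sym (cong (_* w (q ∷ ν)) (𝟙-no (λ Σ≡ → q≰1+k (subst (q ≤_) Σ≡ (ℕP.m≤m+n q (sum ν))))
                                         (q ℕ.+ sum ν ℕ.≟ suc k))))
  selectHead (yes q≤1+k) = begin
    Σℤ (map (λ i → 𝟙 (suc i ℕ.≟ q) * X (suc i)) (upTo N))
      ≡⟨ Σℤ-upTo-single _ N r (ℕP.⊓-glb q≤1+k q≤m)
                        (λ i _ i≢r → cong (_* X (suc i)) (𝟙-no (i≢r ∘ ℕP.suc-injective) (suc i ℕ.≟ q))) ⟩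
    𝟙 (q ℕ.≟ q) * X q
      ≡⟨ trans (cong (_* X q) (𝟙-yes refl (q ℕ.≟ q))) (ℤP.*-identityˡ (X q)) ⟩
    X q
      ≡⟨ Σℤ-partitionsBounded-select f (suc k ∸ q) q ν (w ∘ (q ∷_))
           (ℕP.≤-trans (ℕP.m∸n≤m k r) (ℕP.≤-pred k<1+f)) (descending-tail ν↘) ν⁺ (descending-head ν↘) ⟩
    𝟙 (sum ν ℕ.≟ suc k ∸ q) * w (q ∷ ν)
      ≡⟨ cong (_* w (q ∷ ν)) (𝟙-⇔ (λ eq → trans (cong (q ℕ.+_) eq) (ℕP.m+[n∸m]≡n q≤1+k))
                                  (λ eq → trans (sym (ℕP.m+n∸m≡n q (sum ν))) (cong (_∸ q) eq))
                                  (sum ν ℕ.≟ suc k ∸ q) (q ℕ.+ sum ν ℕ.≟ suc k)) ⟩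
    𝟙 (q ℕ.+ sum ν ℕ.≟ suc k) * w (q ∷ ν) ∎

parts-≤-sum : ∀ xs → All (_≤ sum xs) xs
parts-≤-sum []       = []
parts-≤-sum (x ∷ xs) = ℕP.m≤m+n x (sum xs) ∷ All.map (λ y≤ → ℕP.≤-trans y≤ (ℕP.m≤n+m (sum xs) x)) (parts-≤-sum xs)

partitions-select : ∀ k ν (w : List ℕ → ℤ) → Descending ν → Positive ν →
  Σℤ (map (λ l → 𝟙 (LP.≡-dec ℕ._≟_ l ν) * w l) (partitions k)) ≡ 𝟙 (sum ν ℕ.≟ k) * w ν
partitions-select k ν w ν↘ ν⁺ = bySum (sum ν ℕ.≟ k)
  where
  bySum : (d : Dec (sum ν ≡ k)) → Σℤ (map (λ l → 𝟙 (LP.≡-dec ℕ._≟_ l ν) * w l) (partitions k)) ≡ 𝟙 d * w ν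
  bySum (yes refl) = trans (Σℤ-partitionsBounded-select k k k ν w ℕP.≤-refl ν↘ ν⁺ (parts-≤-sum ν))
                           (cong (_* w ν) (𝟙-yes refl (sum ν ℕ.≟ sum ν)))
  bySum (no Σν≢k)  = trans (Σℤ-congᴬ (partitionsBounded-partition k k k)
                              (λ {l} (_ , _ , Σl≡k) → cong (_* w l)
                                 (𝟙-no (λ l≡ν → Σν≢k (trans (cong sum (sym l≡ν)) Σl≡k)) (LP.≡-dec ℕ._≟_ l ν))))
                           (Σℤ-zero (λ _ → 0ℤ) (partitions k) (λ _ → refl))

nonzero? : Decidable (λ (a : ℕ) → a ≢ 0)
nonzero? a = Dec.¬? (a ℕ.≟ 0)

sum-map-filter-nonzero : ∀ (g : ℕ → ℕ) → g 0 ≡ 0 → ∀ xs → sum (map g (filter nonzero? xs)) ≡ sum (map g xs)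
sum-map-filter-nonzero g g0≡0 []           = refl
sum-map-filter-nonzero g g0≡0 (zero ∷ xs)  = trans (sum-map-filter-nonzero g g0≡0 xs) (cong (ℕ._+ sum (map g xs)) (sym g0≡0))
sum-map-filter-nonzero g g0≡0 (suc x ∷ xs) = cong (g (suc x) ℕ.+_) (sum-map-filter-nonzero g g0≡0 xs)

All-filter-nonzero⁻ : ∀ {P : ℕ → Set} → P 0 → ∀ xs → All P (filter nonzero? xs) → All P xs
All-filter-nonzero⁻ P0 []           _          = []
All-filter-nonzero⁻ P0 (zero ∷ xs)  ps         = P0 ∷ All-filter-nonzero⁻ P0 xs ps
All-filter-nonzero⁻ P0 (suc x ∷ xs) (px ∷ ps) = px ∷ All-filter-nonzero⁻ P0 xs ps

degree-sum : ∀ {n} (e : Mon n) → degree e ≡ sum (toList e)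
degree-sum []      = refl
degree-sum (a ∷ e) = cong (a ℕ.+_) (degree-sum e)

coordProd-hCoeff : ∀ s {n} (e : Mon n) →
  coordProd (λ _ → hCoeff s) e ≡ 𝟙 (admissible? s (toList e)) * sgn (degree e ℕ.+ residueSum s (toList e))
coordProd-hCoeff s []      = refl
coordProd-hCoeff s (a ∷ e) = begin
  hCoeff s a * coordProd (λ _ → hCoeff s) e
    ≡⟨ cong (hCoeff s a *_) (coordProd-hCoeff s e) ⟩
  (𝟙 (residue01? s a) * sgn (a ℕ.+ a % suc s)) * (𝟙 (admissible? s (toList e)) * sgn (degree e ℕ.+ rs))
    ≡⟨ interchange (𝟙 (residue01? s a)) (sgn (a ℕ.+ a % suc s)) (𝟙 (admissible? s (toList e))) _ ⟩
  (𝟙 (residue01? s a) * 𝟙 (admissible? s (toList e))) * (sgn (a ℕ.+ a % suc s) * sgn (degree e ℕ.+ rs))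
    ≡⟨ cong₂ _*_ (sym (𝟙-× (admissible? s (a ∷ toList e)) (residue01? s a) (admissible? s (toList e))
                            (λ { (p ∷ ps) → p , ps }) _∷_))
                 (trans (sym (sgn-+ (a ℕ.+ a % suc s) (degree e ℕ.+ rs)))
                        (cong sgn (regroup a (degree e) (a % suc s) rs))) ⟩
  𝟙 (admissible? s (a ∷ toList e)) * sgn ((a ℕ.+ degree e) ℕ.+ residueSum s (a ∷ toList e)) ∎
  where
  open ≡-Reasoning
  rs : ℕ
  rs = residueSum s (toList e)
  interchange : ∀ a b c d → (a * b) * (c * d) ≡ (a * c) * (b * d)
  interchange = solve-∀
  regroup : ∀ a d r R → (a ℕ.+ r) ℕ.+ (d ℕ.+ R) ≡ (a ℕ.+ d) ℕ.+ (r ℕ.+ R)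
  regroup = ℕSolver.solve-∀

RHS-Σℤ : ∀ s n k (e : Mon n) →
  RHS s n k e ≡ Σℤ (map (λ l → 𝟙 (admissible? s l) * (sgn (k ℕ.+ residueSum s l) * monomialSym l e)) (partitions k))
RHS-Σℤ s n k e = begin
  RHS s n k e
    ≡⟨ foldr-addP (map F (filter (admissible? s) (partitions k))) e ⟩
  Σℤ (map (λ p → p e) (map F (filter (admissible? s) (partitions k))))
    ≡⟨ Σℤ-map-∘ (λ p → p e) F (filter (admissible? s) (partitions k)) ⟩
  Σℤ (map (λ l → F l e) (filter (admissible? s) (partitions k)))
    ≡⟨ Σℤ-filter (partitions k) ⟩
  Σℤ (map (λ l → 𝟙 (admissible? s l) * F l e) (partitions k)) ∎
  where
  open ≡-Reasoning
  F : List ℕ → Poly n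
  F l = scaleP (sgn (k ℕ.+ residueSum s l)) (monomialSym l)
  Σℤ-filter : ∀ ls → Σℤ (map (λ l → F l e) (filter (admissible? s) ls))
                       ≡ Σℤ (map (λ l → 𝟙 (admissible? s l) * F l e) ls)
  Σℤ-filter []       = refl
  Σℤ-filter (l ∷ ls) with admissible? s l
  ... | yes _ = cong₂ _+_ (sym (ℤP.*-identityˡ (F l e))) (Σℤ-filter ls)
  ... | no _  = trans (Σℤ-filter ls) (sym (trans (cong (_+ Σℤ (map (λ l → 𝟙 (admissible? s l) * F l e) ls))
                                                       (ℤP.*-zeroˡ (F l e)))
                                                 (ℤP.+-identityˡ _)))

module _ {n} (e : Mon n) where

  private
    shape↭nonzeroEntries : shape e ↭ nonzeroEntries e
    shape↭nonzeroEntries = ISortP.sort-↭ ≥-decTotalOrder (nonzeroEntries e)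

  shape-descending : Descending (shape e)
  shape-descending = ISortP.sort-↗ ≥-decTotalOrder (nonzeroEntries e)

  shape-positive : Positive (shape e)
  shape-positive = PermP.All-resp-↭ (↭-sym shape↭nonzeroEntries) (AllP.all-filter nonzero? (toList e))

  sum-shape : sum (shape e) ≡ degree e
  sum-shape = begin
    sum (shape e)                            ≡⟨ ℕLP.sum-↭ shape↭nonzeroEntries ⟩
    sum (nonzeroEntries e)                   ≡⟨ cong sum (LP.map-id (nonzeroEntries e)) ⟨
    sum (map (λ x → x) (nonzeroEntries e))   ≡⟨ sum-map-filter-nonzero (λ x → x) refl (toList e) ⟩
    sum (map (λ x → x) (toList e))           ≡⟨ cong sum (LP.map-id (toList e)) ⟩
    sum (toList e)                           ≡⟨ degree-sum e ⟨
    degree e                                 ∎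
    where open ≡-Reasoning

  residueSum-shape : ∀ s → residueSum s (shape e) ≡ residueSum s (toList e)
  residueSum-shape s = trans (ℕLP.sum-↭ (PermP.map⁺ (_% suc s) shape↭nonzeroEntries))
                             (sum-map-filter-nonzero (_% suc s) refl (toList e))

  admissible-shape : ∀ s → 𝟙 (admissible? s (shape e)) ≡ 𝟙 (admissible? s (toList e))
  admissible-shape s =
    𝟙-⇔ (λ adm → All-filter-nonzero⁻ (inj₁ refl) (toList e) (PermP.All-resp-↭ shape↭nonzeroEntries adm))
        (λ adm → PermP.All-resp-↭ (↭-sym shape↭nonzeroEntries) (AllP.filter⁺ nonzero? adm)) _ _

RHS-homPart : ∀ s n k → RHS s n k ≗ homPart (coordProd (λ _ → hCoeff s)) k
RHS-homPart s n k e = begin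
  RHS s n k e
    ≡⟨ RHS-Σℤ s n k e ⟩
  Σℤ (map (λ l → 𝟙 (admissible? s l) * (sgn (k ℕ.+ residueSum s l) * monomialSym l e)) (partitions k))
    ≡⟨ Σℤ-congᴬ (partitionsBounded-partition k k k) (λ {l} (l↘ , _) → selectorForm l l↘) ⟩
  Σℤ (map (λ l → 𝟙 (LP.≡-dec ℕ._≟_ l (shape e)) * w l) (partitions k))
    ≡⟨ partitions-select k (shape e) w (shape-descending e) (shape-positive e) ⟩
  𝟙 (sum (shape e) ℕ.≟ k) * (𝟙 (admissible? s (shape e)) * sgn (k ℕ.+ residueSum s (shape e)))
    ≡⟨ cong₂ _*_ (𝟙-⇔ (trans (sym (sum-shape e))) (trans (sum-shape e)) (sum (shape e) ℕ.≟ k) (degree e ℕ.≟ k))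
                 (cong₂ (λ a r → a * sgn (k ℕ.+ r)) (admissible-shape e s) (residueSum-shape e s)) ⟩
  𝟙 (degree e ℕ.≟ k) * (𝟙 (admissible? s (toList e)) * sgn (k ℕ.+ residueSum s (toList e)))
    ≡⟨ 𝟙-≟-subst (degree e ℕ.≟ k) (λ d → 𝟙 (admissible? s (toList e)) * sgn (d ℕ.+ residueSum s (toList e))) ⟩
  𝟙 (degree e ℕ.≟ k) * (𝟙 (admissible? s (toList e)) * sgn (degree e ℕ.+ residueSum s (toList e)))
    ≡⟨ cong (𝟙 (degree e ℕ.≟ k) *_) (coordProd-hCoeff s e) ⟨
  homPart (coordProd (λ _ → hCoeff s)) k e ∎
  where
  open ≡-Reasoning
  w : List ℕ → ℤ
  w l = 𝟙 (admissible? s l) * sgn (k ℕ.+ residueSum s l)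
  selectorForm : ∀ l → Descending l →
    𝟙 (admissible? s l) * (sgn (k ℕ.+ residueSum s l) * monomialSym l e) ≡ 𝟙 (LP.≡-dec ℕ._≟_ l (shape e)) * w l
  selectorForm l l↘ = trans (cong (λ z → 𝟙 (admissible? s l) * (sgn (k ℕ.+ residueSum s l) * z))
                                  (monomialSym-descending l e l↘))
                            (rotate (𝟙 (admissible? s l)) (sgn (k ℕ.+ residueSum s l)) (𝟙 (LP.≡-dec ℕ._≟_ l (shape e))))
    where
    rotate : ∀ a b c → a * (b * c) ≡ c * (a * b)
    rotate = solve-∀

theorem4p4 : (k n s : ℕ) → 1 ≤ k → 1 ≤ n → 1 ≤ s →
    (e : Vec ℕ n) → H s n k e ≡ RHS s n k e
theorem4p4 k n s _ _ 1≤s e = begin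
  H s n k e    ≡⟨ invS-unique (factorProduct s n) G constantTerm product k e ⟩
  G k e        ≡⟨ RHS-homPart s n k e ⟨
  RHS s n k e  ∎
  where
  open ≡-Reasoning
  G : PS n
  G = homPart (coordProd (λ _ → hCoeff s))
  constantTerm : factorProduct s n 0 ≗ oneP
  constantTerm e = begin
    factorProduct s n 0 e                        ≡⟨ factorProduct-homPart s n 0 e ⟩
    homPart (coordProd (λ _ → altGeom s)) 0 e    ≡⟨ homPart-zero (λ _ → altGeom s) (λ _ → refl) e ⟩
    coordProd (λ _ → δ) e                        ≡⟨ oneP-coordProd-δ e ⟨
    oneP e                                       ∎
  product : ∀ j → mulS (factorProduct s n) G j ≗ oneS j
  product j e = begin
    mulS (factorProduct s n) G j e
      ≡⟨ mulS-homPart _ G _ _ (factorProduct-homPart s n) (λ _ _ → refl) j e ⟩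
    homPart (mulP (coordProd (λ _ → altGeom s)) (coordProd (λ _ → hCoeff s))) j e
      ≡⟨ cong (𝟙 (degree e ℕ.≟ j) *_) (mulP-coordProd (λ _ → altGeom s) (λ _ → hCoeff s) e) ⟩
    homPart (coordProd (λ _ → conv (altGeom s) (hCoeff s))) j e
      ≡⟨ cong (𝟙 (degree e ℕ.≟ j) *_) (coordProd-cong (λ _ → conv-altGeom-hCoeff s 1≤s) e) ⟩
    homPart (coordProd (λ _ → δ)) j e
      ≡⟨ oneS-homPart j e ⟨
    oneS j e ∎
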